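{- Let $\mathfrak L$ and $\mathfrak L'$ be languages with value domains $\mathbb V$ and $\mathbb V'$, let $\mathcal T:\mathbb T_{\mathfrak L}\to\mathbb T_{\mathfrak L'}$ be a translation from $\mathfrak L$ into $\mathfrak L'$, and let $\sim$ and $\approx$ be equivalence relations on a class $\mathbb Z\supseteq\mathbb V\cup\mathbb V'$, both of which are congruences for $\mathcal T(\mathfrak L)$, such that $\sim$ is finer than $\approx$ (i.e. $p\sim q$ implies $p\approx q$ for all $p,q\in\mathbb Z$). If $\mathcal T$ is correct up to $\sim$, then $\mathcal T$ is also correct up to $\approx$.
   Context: Fix a set $\mathcal V$ of variables. A language $\mathfrak L$ consists of a set $\mathbb T_{\mathfrak L}$ of expressions built from variables in $\mathcal V$ by means of operators (and possibly recursion constructs), a domain of values $\mathbb V$, and a semantic mapping $[\![\cdot]\!]_{\mathfrak L}:\mathbb T_{\mathfrak L}\to((\mathcal V\to\mathbb V)\to\mathbb V)$; a function $\rho:\mathcal V\to\mathbb V$ is a valuation. For an equivalence $R$ on $\mathbb Z$, valuations $\eta,\rho:\mathcal V\to\mathbb Z$ satisfy $\eta\,R\,\rho$ if $\eta(X)\,R\,\rho(X)$ for all $X\in\mathcal V$. A translation $\mathcal T$ is correct up to $R$ if (i) for every $v\in\mathbb V$ there is $v'\in\mathbb V'$ with $v'\,R\,v$, and (ii) $[\![\mathcal T(E)]\!]_{\mathfrak L'}(\eta)\,R\,[\![E]\!]_{\mathfrak L}(\rho)$ for all $E\in\mathbb T_{\mathfrak L}$ and all valuations $\eta:\mathcal V\to\mathbb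 V'$, $\rho:\mathcal V\to\mathbb V$ with $\eta\,R\,\rho$. Let $\mathbb U^R:=\{v'\in\mathbb V'\mid\exists v\in\mathbb V.\ v'\,R\,v\}$. The equivalence $R$ is a congruence for $\mathcal T(\mathfrak L)$ if $[\![\mathcal T(E)]\!]_{\mathfrak L'}(\nu)\,R\,[\![\mathcal T(E)]\!]_{\mathfrak L'}(\eta)$ for every $E\in\mathbb T_{\mathfrak L}$ and all valuations $\nu,\eta:\mathcal V\to\mathbb U^R$ with $\nu\,R\,\eta$. -}

module Defs where

open import Level using (0ℓ)
open import Data.Product using (Σ; ∃; _×_; _,_; proj₁; proj₂)
open import Relation.Binary.Core using (Rel)
open import Relation.Binary.Structures using (IsEquivalence)

-- A language over variables Var, with values drawn from a subclass of the
-- ambient class Z (given by a predicate Val on Z).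
record Language (Var Z : Set) : Set₁ where
  field
    Term : Set
    Val  : Z → Set
    ⟦_⟧  : Term → (Var → Σ Z Val) → Σ Z Val
open Language public

Valuation : {Var Z : Set} → (Z → Set) → Set
Valuation {Var} {Z} P = Var → Σ Z P

_⟨_⟩ᵥ_ : {Var Z : Set} {P Q : Z → Set} → (Var → Σ Z P) → Rel Z 0ℓ → (Var → Σ Z Q) → Set
η ⟨ R ⟩ᵥ ρ = ∀ X → R (proj₁ (η X)) (proj₁ (ρ X))

Translation : {Var Z : Set} → Language Var Z → Language Var Z → Set
Translation L L′ = Term L → Term L′

CorrectUpTo : {Var Z : Set} (L L′ : Language Var Z) → Translation L L′ → Rel Z 0ℓ → Set
CorrectUpTo {Z = Z} L L′ T R =
  ((v : Σ Z (Val L)) → Σ (Σ Z (Val L′)) λ v′ → R (proj₁ v′) (proj₁ v))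
  × (∀ (E : Term L) (η : Valuation (Val L′)) (ρ : Valuation (Val L)) →
       η ⟨ R ⟩ᵥ ρ → R (proj₁ (⟦ L′ ⟧ (T E) η)) (proj₁ (⟦ L ⟧ E ρ)))

-- 𝕌^R = { v′ ∈ 𝕍′ | ∃ v ∈ 𝕍. v′ R v }
InU : {Var Z : Set} (L L′ : Language Var Z) → Rel Z 0ℓ → Z → Set
InU {Z = Z} L L′ R z = Val L′ z × (Σ Z λ v → Val L v × R z v)

CongruenceFor : {Var Z : Set} (L L′ : Language Var Z) → Translation L L′ → Rel Z 0ℓ → Set
CongruenceFor L L′ T R =
  ∀ (E : Term L) (ν η : Valuation (InU L L′ R)) → ν ⟨ R ⟩ᵥ η →
    R (proj₁ (⟦ L′ ⟧ (T E) (λ X → proj₁ (ν X) , proj₁ (proj₂ (ν X)))))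
      (proj₁ (⟦ L′ ⟧ (T E) (λ X → proj₁ (η X) , proj₁ (proj₂ (η X)))))

module Submission where

open import Defs
open import Level using (0ℓ)
open import Data.Product using (Σ; _,_; proj₁; proj₂)
open import Relation.Binary.Core using (Rel; _⇒_)
open import Relation.Binary.Structures using (IsEquivalence)

-- Idea: given η ≈ ρ, pick a ∼-representative ν′ X ∈ 𝕍′ of each ρ X. Correctness
-- up to ∼ gives 𝒯(E)(ν′) ∼ E(ρ), hence ≈. Both η and ν′ take values in 𝕌^≈ and
-- η ≈ ν′ pointwise, so the ≈-congruence gives 𝒯(E)(η) ≈ 𝒯(E)(ν′).

module _ {Var Z : Set} (L L′ : Language Var Z) where

  private
    Source Target : Set
    Source = Valuation {Var} (Val L)
    Target = Valuation {Var} (Val L′)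

  Representatives : Rel Z 0ℓ → Set
  Representatives R = (v : Σ Z (Val L)) → Σ (Σ Z (Val L′)) λ v′ → R (proj₁ v′) (proj₁ v)

  representatives-mono : ∀ {R S} → R ⇒ S → Representatives R → Representatives S
  representatives-mono R⇒S rep v = proj₁ (rep v) , R⇒S (proj₂ (rep v))

  representativeValuation : ∀ {R} → Representatives R → Source → Target
  representativeValuation rep ρ X = proj₁ (rep (ρ X))

  inU-valuation : ∀ {R} (η : Target) (ρ : Source) →
                  η ⟨ R ⟩ᵥ ρ → Valuation {Var} (InU L L′ R)
  inU-valuation η ρ ηRρ X = proj₁ (η X) , proj₂ (η X) , proj₁ (ρ X) , proj₂ (ρ X) , ηRρ X

  congruence⇒⟦T⟧-cong : ∀ {R} (T : Translation L L′) → IsEquivalence R →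
    CongruenceFor L L′ T R →
    ∀ E (η ν : Target) (ρ : Source) →
    η ⟨ R ⟩ᵥ ρ → ν ⟨ R ⟩ᵥ ρ → R (proj₁ (⟦ L′ ⟧ (T E) η)) (proj₁ (⟦ L′ ⟧ (T E) ν))
  congruence⇒⟦T⟧-cong T isEq cong E η ν ρ ηRρ νRρ =
    cong E (inU-valuation η ρ ηRρ) (inU-valuation ν ρ νRρ)
         (λ X → trans (ηRρ X) (sym (νRρ X)))
    where open IsEquivalence isEq

theorem1 : {Var Z : Set} (L L′ : Language Var Z) (T : Translation L L′)
    (_∼_ _≈_ : Rel Z 0ℓ) →
    IsEquivalence _∼_ → IsEquivalence _≈_ →
    CongruenceFor L L′ T _∼_ → CongruenceFor L L′ T _≈_ →
    (∀ {p q} → p ∼ q → p ≈ q) →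
    CorrectUpTo L L′ T _∼_ → CorrectUpTo L L′ T _≈_
theorem1 {Var} L L′ T _∼_ _≈_ _ ≈-isEq _ ≈-cong ∼⇒≈ (rep , correct∼) =
  representatives-mono L L′ ∼⇒≈ rep , correct≈
  where
  open IsEquivalence ≈-isEq using (trans)

  correct≈ : ∀ E η ρ → η ⟨ _≈_ ⟩ᵥ ρ →
             proj₁ (⟦ L′ ⟧ (T E) η) ≈ proj₁ (⟦ L ⟧ E ρ)
  correct≈ E η ρ η≈ρ =
    trans (congruence⇒⟦T⟧-cong L L′ T ≈-isEq ≈-cong E η ν′ ρ η≈ρ (λ X → ∼⇒≈ (ν′∼ρ X)))
          (∼⇒≈ (correct∼ E ν′ ρ ν′∼ρ))
    where
    ν′ : Valuation {Var} (Val L′)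
    ν′ = representativeValuation L L′ rep ρ
    ν′∼ρ : ν′ ⟨ _∼_ ⟩ᵥ ρ
    ν′∼ρ X = proj₂ (rep (ρ X))
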